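{- Let $(T,L,c)$ be a shadow-complete WDTAP instance, let $a\in A$ and let $u$ be an endpoint of $a$. Let $x$ be a feasible solution to the LP $\min\{c^\top x: Mx\ge\mathbf 1,x\ge 0\}$ such that for every $\ell\in\mathrm{supp}(x)$ with $a\in\overrightarrow{\mathrm{cov}}(\ell)$, $u$ is an endpoint of $\ell$. Let $v\in V$, $L'\subseteq L$ and $x'=\mathrm{split}(x,\sigma_{v,L'})$. Then for every $\ell\in\mathrm{supp}(x')$ with $a\in\overrightarrow{\mathrm{cov}}(\ell)$, $u$ is an endpoint of $\ell$.
   Context: WDTAP instance: oriented tree $T=(V,A)$, links $L\subseteq V\times V$, costs $c$. For $\ell=(u,v)$, $P_\ell$ is the $u$-$v$ path in the underlying undirected tree traversed from $u$ to $v$; $\overrightarrow{\mathrm{cov}}(\ell)$ is the set of its arcs traversed against their orientation; $M_{a,\ell}=1$ iff $a\in\overrightarrow{\mathrm{cov}}(\ell)$; $\mathrm{supp}(x)=\{\ell: x_\ell>0\}$. A shadow of $\ell=(u,v)$ is a link $(u',v')$ with $u',v'$ on $P_\ell$, $u'$ before $v'$ from $u$ to $v$; shadow-complete: every shadow of every $\ell\in L$ is in $L$ with cost at most $c(\ell)$. $\mathrm{split}(x,\sigma)_{\ell'}=\sum_{\ell:\ell'\in\sigma(\ell)}x_\ell$. For $v\in V$, $L'\subseteq L$, the splitting $\sigma_{v,L'}$ maps each $\ell=(y,z)\in L'$ with $v$ an inner vertex of $P_\ell$ to $\{(y,v),(v,z)\}$ and every other link $\ell$ to $\{\ell\}$.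
   Formalization: The costs c and the feasible LP solution x take rational values, so the coverage matrix M and the split solution x′ are rational as well. -}

module Defs where

open import Data.Nat using (ℕ)
open import Data.Fin using (Fin)
import Data.Fin.Properties as FinP
open import Data.Product using (Σ; ∃; ∃-syntax; _×_; _,_; proj₁; proj₂)
open import Data.Product.Properties using (≡-dec)
open import Data.Sum using (_⊎_)
open import Data.List using (List; []; _∷_; _++_; map; foldr)
open import Data.List.Membership.Propositional using (_∈_; _∉_)
open import Data.List.Relation.Unary.Unique.Propositional using (Unique)
open import Data.List.Relation.Unary.Linked using (Linked)
open import Data.Rational using (ℚ; 0ℚ; 1ℚ; _+_; _*_; _≤_; _<_)
open import Data.Bool using (if_then_else_)
open import Relation.Nullary using (¬_; Dec)
open import Relation.Nullary.Decidable using (⌊_⌋)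
open import Relation.Binary using (DecidableEquality)
open import Relation.Binary.PropositionalEquality using (_≡_; _≢_)
import Data.List.Membership.DecPropositional as DecMem

-- Vertices are Fin n. An arc (p , q) is oriented from p to q.
-- A link (u , v) is an ordered pair of vertices.
Vertex : ℕ → Set
Vertex n = Fin n

Arc : ℕ → Set
Arc n = Vertex n × Vertex n

Link : ℕ → Set
Link n = Vertex n × Vertex n

_≟L_ : ∀ {n} → DecidableEquality (Link n)
_≟L_ = ≡-dec FinP._≟_ FinP._≟_

module _ {n : ℕ} (A : List (Arc n)) where

  Adj : Vertex n → Vertex n → Set
  Adj p q = (p , q) ∈ A ⊎ (q , p) ∈ A

  IsPath : Vertex n → Vertex n → List (Vertex n) → Set
  IsPath u v ps =
    Linked Adj ps × Unique ps ×
    (∃[ xs ] ps ≡ u ∷ xs) × (∃[ ys ] ps ≡ ys ++ (v ∷ []))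

  record IsOrientedTree : Set where
    field
      noLoops      : ∀ p q → (p , q) ∈ A → p ≢ q
      arcsDistinct : Unique A
      noAntiparallel : ∀ p q → (p , q) ∈ A → (q , p) ∉ A
      connected    : ∀ u v → ∃[ ps ] IsPath u v ps
      pathsUnique  : ∀ u v ps qs → IsPath u v ps → IsPath u v qs → ps ≡ qs

  Consecutive : Vertex n → Vertex n → List (Vertex n) → Set
  Consecutive p q ps = ∃[ xs ] ∃[ ys ] ps ≡ xs ++ (p ∷ q ∷ ys)

  Before : Vertex n → Vertex n → List (Vertex n) → Set
  Before p q ps = ∃[ xs ] ∃[ ys ] ∃[ zs ] ps ≡ xs ++ (p ∷ ys ++ (q ∷ zs))

  -- arc a = (p , q) ∈ cov→(ℓ): the path P_ℓ traversed from u to v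
  -- uses a against its orientation, i.e. goes from q to p.
  Covers : Link n → Arc n → Set
  Covers (u , v) (p , q) = ∃[ ps ] IsPath u v ps × Consecutive q p ps

  Shadow : Link n → Link n → Set
  Shadow (u , v) (u' , v') = ∃[ ps ] IsPath u v ps × Before u' v' ps

  Inner : Link n → Vertex n → Set
  Inner (y , z) w = ∃[ ps ] IsPath y z ps × w ∈ ps × w ≢ y × w ≢ z

  ShadowComplete : List (Link n) → (Link n → ℚ) → Set
  ShadowComplete L c = ∀ ℓ ℓ' → ℓ ∈ L → Shadow ℓ ℓ' → ℓ' ∈ L × c ℓ' ≤ c ℓ

  IsCoverageMatrix : List (Link n) → (Arc n → Link n → ℚ) → Set
  IsCoverageMatrix L M = ∀ a ℓ → a ∈ A → ℓ ∈ L →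
    (Covers ℓ a → M a ℓ ≡ 1ℚ) × (¬ Covers ℓ a → M a ℓ ≡ 0ℚ)

  IsSplitting : List (Link n) → List (Link n) → Vertex n → (Link n → List (Link n)) → Set
  IsSplitting L L' w σ = ∀ ℓ → ℓ ∈ L →
    ((ℓ ∈ L' × Inner ℓ w) → σ ℓ ≡ (proj₁ ℓ , w) ∷ (w , proj₂ ℓ) ∷ []) ×
    (¬ (ℓ ∈ L' × Inner ℓ w) → σ ℓ ≡ ℓ ∷ [])

sumℚ : List ℚ → ℚ
sumℚ = foldr _+_ 0ℚ

sumOver : ∀ {n} → List (Link n) → (Link n → ℚ) → ℚ
sumOver L f = sumℚ (map f L)

Feasible : ∀ {n} → List (Arc n) → List (Link n) → (Arc n → Link n → ℚ) → (Link n → ℚ) → Set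
Feasible A L M x =
  (∀ ℓ → ℓ ∈ L → 0ℚ ≤ x ℓ) ×
  (∀ a → a ∈ A → 1ℚ ≤ sumOver L (λ ℓ → M a ℓ * x ℓ))

split : ∀ {n} → List (Link n) → (Link n → ℚ) → (Link n → List (Link n)) → Link n → ℚ
split {n} L x σ ℓ' = sumOver L (λ ℓ → if ⌊ ℓ' ∈? σ ℓ ⌋ then x ℓ else 0ℚ)
  where open DecMem (_≟L_ {n}) using (_∈?_)

InSupp : ∀ {n} → List (Link n) → (Link n → ℚ) → Link n → Set
InSupp L x ℓ = ℓ ∈ L × 0ℚ < x ℓ

IsEndpoint : ∀ {n} → Vertex n → Vertex n × Vertex n → Set
IsEndpoint u (p , q) = u ≡ p ⊎ u ≡ q

{-# OPTIONS --safe #-}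
module Submission where

-- A link ℓ' in the support of split(x, σ_{v,L'}) comes from a link ℓ = (y , z) in the support
-- of x, and is either ℓ itself or one of its halves (y , v), (v , z) at an inner vertex v.
-- A half is a shadow of ℓ, and the tree path of a shadow is a segment of P_ℓ.  Hence if ℓ'
-- covers a, so does ℓ, and u ∈ {y , z}; as u is an endpoint of a it lies on the segment, and
-- since P_ℓ is simple an endpoint of P_ℓ lying on a segment is an endpoint of that segment.

open import Defs
open import Data.Nat using (ℕ)
open import Data.Product using (_×_; ∃-syntax; ∃₂; _,_; proj₁; proj₂)
open import Data.List using (List; []; _∷_; _++_)
open import Data.List.Membership.Propositional using (_∈_)
open import Data.List.Relation.Unary.Unique.Propositional using (Unique)
open import Data.Rational using (ℚ; 0ℚ; _+_; _<_)

open import Data.Bool using (if_then_else_)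
open import Data.Empty using (⊥-elim)
open import Data.Fin.Properties using (_≟_)
open import Data.List.Properties using (++-assoc; ∷-injectiveʳ)
open import Data.List.Membership.Propositional.Properties using (∈-∃++; ∈-++⁺ˡ; ∈-++⁺ʳ)
open import Data.List.Relation.Binary.Disjoint.Propositional using (Disjoint)
import Data.List.Relation.Unary.All as All
open import Data.List.Relation.Unary.All.Properties using (++⁻ˡ; ++⁻ʳ)
open import Data.List.Relation.Unary.AllPairs using ([]; _∷_)
open import Data.List.Relation.Unary.Any using (here; there)
open import Data.List.Relation.Unary.Linked using (Linked; []; [-]; _∷_; tail)
import Data.List.Membership.DecPropositional as DecMembership
open import Data.Rational.Properties using (_<?_; ≮⇒≥; <-irrefl; <-≤-trans; +-mono-≤)
open import Data.Sum using (_⊎_; inj₁; inj₂; [_,_])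
open import Relation.Binary.PropositionalEquality using (_≡_; refl; sym; trans; cong; subst; module ≡-Reasoning)
open import Relation.Nullary using (¬_; Dec; yes; no)
open import Relation.Nullary.Decidable using (⌊_⌋; _⊎-dec_; decidable-stable; ¬¬-excluded-middle)
open import Relation.Nullary.Negation using (¬¬-map)

+-positive⁻ : ∀ p q → 0ℚ < p + q → 0ℚ < p ⊎ 0ℚ < q
+-positive⁻ p q 0<p+q with 0ℚ <? p | 0ℚ <? q
... | yes 0<p | _     = inj₁ 0<p
... | no _    | yes 0<q = inj₂ 0<q
... | no 0≮p  | no 0≮q =
  ⊥-elim (<-irrefl refl (<-≤-trans 0<p+q (+-mono-≤ (≮⇒≥ 0≮p) (≮⇒≥ 0≮q))))

sumOver-positive⁻ : ∀ {n} (L : List (Link n)) (f : Link n → ℚ) →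
  0ℚ < sumOver L f → ∃[ ℓ ] ℓ ∈ L × 0ℚ < f ℓ
sumOver-positive⁻ [] f 0<0 = ⊥-elim (<-irrefl refl 0<0)
sumOver-positive⁻ (ℓ ∷ L) f 0<sum with +-positive⁻ (f ℓ) (sumOver L f) 0<sum
... | inj₁ 0<fℓ = ℓ , here refl , 0<fℓ
... | inj₂ 0<rest with sumOver-positive⁻ L f 0<rest
...   | k , k∈L , 0<fk = k , there k∈L , 0<fk

if-positive⁻ : ∀ {P : Set} (d : Dec P) (q : ℚ) → 0ℚ < (if ⌊ d ⌋ then q else 0ℚ) → P × 0ℚ < q
if-positive⁻ (yes p) q 0<q = p , 0<q
if-positive⁻ (no _)  q 0<0 = ⊥-elim (<-irrefl refl 0<0)

module _ {n : ℕ} where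
  open DecMembership (_≟L_ {n}) using (_∈?_)

  split-positive⁻ : (L : List (Link n)) (x : Link n → ℚ) (σ : Link n → List (Link n)) (ℓ' : Link n) →
    0ℚ < split L x σ ℓ' → ∃[ ℓ ] InSupp L x ℓ × ℓ' ∈ σ ℓ
  split-positive⁻ L x σ ℓ' 0<x'ℓ'
    with ℓ , ℓ∈L , 0<term ← sumOver-positive⁻ L _ 0<x'ℓ'
    with ℓ'∈σℓ , 0<xℓ ← if-positive⁻ (ℓ' ∈? σ ℓ) (x ℓ) 0<term
    = ℓ , (ℓ∈L , 0<xℓ) , ℓ'∈σℓ

isEndpoint? : ∀ {n} (u : Vertex n) (ℓ : Vertex n × Vertex n) → Dec (IsEndpoint u ℓ)
isEndpoint? u (p , q) = (u ≟ p) ⊎-dec (u ≟ q)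

module _ {X : Set} where

  head-∈-++ : ∀ (as : List X) {b bs y hs} → y ∷ hs ≡ as ++ b ∷ bs → y ≡ b ⊎ y ∈ as
  head-∈-++ []       refl = inj₁ refl
  head-∈-++ (a ∷ as) refl = inj₂ (here refl)

  last-∈-++ : ∀ (ws as : List X) {b bs z} → ws ++ z ∷ [] ≡ as ++ b ∷ bs → z ≡ b ⊎ z ∈ bs
  last-∈-++ []       []           refl = inj₁ refl
  last-∈-++ (w ∷ ws) []           refl = inj₂ (∈-++⁺ʳ ws (here refl))
  last-∈-++ []       (a ∷ [])     ()
  last-∈-++ []       (a ∷ _ ∷ _)  ()
  last-∈-++ (w ∷ ws) (a ∷ as)     eq   = last-∈-++ ws as (∷-injectiveʳ eq)

  Linked-++⁻ˡ : ∀ {R : X → X → Set} xs {ys} → Linked R (xs ++ ys) → Linked R xs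
  Linked-++⁻ˡ []           _         = []
  Linked-++⁻ˡ (x ∷ [])     _         = [-]
  Linked-++⁻ˡ (x ∷ y ∷ xs) (r ∷ rxs) = r ∷ Linked-++⁻ˡ (y ∷ xs) rxs

  Linked-++⁻ʳ : ∀ {R : X → X → Set} xs {ys} → Linked R (xs ++ ys) → Linked R ys
  Linked-++⁻ʳ []       rys  = rys
  Linked-++⁻ʳ (x ∷ xs) rxys = Linked-++⁻ʳ xs (tail rxys)

  Unique-++⁻ : ∀ xs {ys : List X} → Unique (xs ++ ys) → Unique xs × Unique ys × Disjoint xs ys
  Unique-++⁻ []       u = [] , u , λ ()
  Unique-++⁻ (x ∷ xs) (x∉ ∷ u) with uxs , uys , xs#ys ← Unique-++⁻ xs u =
    ++⁻ˡ xs x∉ ∷ uxs , uys , disjoint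
    where
      disjoint : Disjoint (x ∷ xs) _
      disjoint (here refl , w∈ys) = All.lookup (++⁻ʳ xs x∉) w∈ys refl
      disjoint (there w∈xs , w∈ys) = xs#ys (w∈xs , w∈ys)

module _ {n : ℕ} (A : List (Arc n)) where

  segment-isPath : ∀ {y z s t} xs ys zs →
    IsPath A y z (xs ++ (s ∷ ys ++ t ∷ []) ++ zs) → IsPath A s t (s ∷ ys ++ t ∷ [])
  segment-isPath {s = s} {t} xs ys zs (linked , unique , _ , _) =
    Linked-++⁻ˡ (s ∷ ys ++ t ∷ []) (Linked-++⁻ʳ xs linked) ,
    proj₁ (Unique-++⁻ (s ∷ ys ++ t ∷ []) (proj₁ (proj₂ (Unique-++⁻ xs unique)))) ,
    (ys ++ t ∷ [] , refl) , (s ∷ ys , refl)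

  consecutive-infix : ∀ {q p} xs {qs} zs → Consecutive A q p qs → Consecutive A q p (xs ++ qs ++ zs)
  consecutive-infix {q} {p} xs zs (as , bs , refl) = xs ++ as , bs ++ zs , (begin
    xs ++ (as ++ q ∷ p ∷ bs) ++ zs  ≡⟨ cong (xs ++_) (++-assoc as (q ∷ p ∷ bs) zs) ⟩
    xs ++ as ++ q ∷ p ∷ bs ++ zs    ≡⟨ sym (++-assoc xs as (q ∷ p ∷ bs ++ zs)) ⟩
    (xs ++ as) ++ q ∷ p ∷ bs ++ zs  ∎)
    where open ≡-Reasoning

  consecutive-endpoint : ∀ {p q w qs} → Consecutive A q p qs → IsEndpoint w (p , q) → w ∈ qs
  consecutive-endpoint (as , _ , refl) (inj₁ refl) = ∈-++⁺ʳ as (there (here refl))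
  consecutive-endpoint (as , _ , refl) (inj₂ refl) = ∈-++⁺ʳ as (here refl)

  infix-endpoint : ∀ {y z s t w} xs qs zs → IsPath A y z (xs ++ qs ++ zs) → IsPath A s t qs →
    w ∈ qs → IsEndpoint w (y , z) → IsEndpoint w (s , t)
  infix-endpoint {y} {z} {s} {t} {w} xs qs zs (_ , unique , (_ , starts) , (ws , ends)) (_ , _ , qs-starts , qs-ends) w∈qs
    = [ start-on-segment qs-starts , end-on-segment qs-ends ]
    where
      xs#qszs : Disjoint xs (qs ++ zs)
      xs#qszs = proj₂ (proj₂ (Unique-++⁻ xs unique))
      qs#zs : Disjoint qs zs
      qs#zs = proj₂ (proj₂ (Unique-++⁻ qs (proj₁ (proj₂ (Unique-++⁻ xs unique)))))

      start-on-segment : ∃[ rs ] qs ≡ s ∷ rs → w ≡ y → IsEndpoint w (s , t)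
      start-on-segment (rs , refl) refl with head-∈-++ xs (sym starts)
      ... | inj₁ w≡s  = inj₁ w≡s
      ... | inj₂ w∈xs = ⊥-elim (xs#qszs (w∈xs , ∈-++⁺ˡ w∈qs))

      end-on-segment : ∃[ rs ] qs ≡ rs ++ t ∷ [] → w ≡ z → IsEndpoint w (s , t)
      end-on-segment (rs , refl) refl with last-∈-++ ws (xs ++ rs) (trans (sym ends) (begin
        xs ++ (rs ++ t ∷ []) ++ zs  ≡⟨ cong (xs ++_) (++-assoc rs (t ∷ []) zs) ⟩
        xs ++ rs ++ t ∷ zs          ≡⟨ sym (++-assoc xs rs (t ∷ zs)) ⟩
        (xs ++ rs) ++ t ∷ zs        ∎))
        where open ≡-Reasoning
      ... | inj₁ w≡t  = inj₂ w≡t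
      ... | inj₂ w∈zs = ⊥-elim (qs#zs (w∈qs , w∈zs))

  inner-half-shadow : ∀ {y z v ℓ'} → Inner A (y , z) v → ℓ' ∈ (y , v) ∷ (v , z) ∷ [] → Shadow A (y , z) ℓ'
  inner-half-shadow {y} {z} {v} (_ , isPath@(_ , _ , (_ , starts) , (ws , ends)) , v∈ps , v≢y , v≢z) half
    with ∈-∃++ v∈ps
  ... | xs , ys , refl = shadow half
    where
      shadow : ∀ {ℓ'} → ℓ' ∈ (y , v) ∷ (v , z) ∷ [] → Shadow A (y , z) ℓ'
      shadow (here refl) with head-∈-++ xs (sym starts)
      ... | inj₁ y≡v  = ⊥-elim (v≢y (sym y≡v))
      ... | inj₂ y∈xs with xs₁ , xs₂ , xs≡ ← ∈-∃++ y∈xs =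
        _ , isPath , xs₁ , xs₂ , ys ,
        trans (cong (_++ v ∷ ys) xs≡) (++-assoc xs₁ (y ∷ xs₂) (v ∷ ys))
      shadow (there (here refl)) with last-∈-++ ws xs (sym ends)
      ... | inj₁ z≡v  = ⊥-elim (v≢z (sym z≡v))
      ... | inj₂ z∈ys with ys₁ , ys₂ , ys≡ ← ∈-∃++ z∈ys =
        _ , isPath , xs , ys₁ , ys₂ , cong (λ rs → xs ++ v ∷ rs) ys≡

  module _ (tree : IsOrientedTree A) where
    open IsOrientedTree tree using (pathsUnique)

    shadow-path-infix : ∀ {y z s t qs} → Shadow A (y , z) (s , t) → IsPath A s t qs →
      ∃₂ λ xs zs → IsPath A y z (xs ++ qs ++ zs)
    shadow-path-infix {y} {z} {s} {t} {qs} (_ , isPath , xs , ys , zs , refl) qs-isPath =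
      xs , zs , subst (λ rs → IsPath A y z (xs ++ rs ++ zs)) (sym qs≡segment) isPath′
      where
        isPath′ : IsPath A y z (xs ++ (s ∷ ys ++ t ∷ []) ++ zs)
        isPath′ = subst (IsPath A y z) (cong (λ rs → xs ++ s ∷ rs) (sym (++-assoc ys (t ∷ []) zs))) isPath
        qs≡segment : qs ≡ s ∷ ys ++ t ∷ []
        qs≡segment = pathsUnique s t qs _ qs-isPath (segment-isPath xs ys zs isPath′)

    shadow-covers : ∀ {ℓ ℓ' a} → Shadow A ℓ ℓ' → Covers A ℓ' a → Covers A ℓ a
    shadow-covers shadow (_ , qs-isPath , consecutive)
      with xs , zs , isPath ← shadow-path-infix shadow qs-isPath =
      _ , isPath , consecutive-infix xs zs consecutive

    shadow-endpoint : ∀ {y z s t w qs} → Shadow A (y , z) (s , t) → IsPath A s t qs →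
      w ∈ qs → IsEndpoint w (y , z) → IsEndpoint w (s , t)
    shadow-endpoint shadow qs-isPath
      with xs , zs , isPath ← shadow-path-infix shadow qs-isPath =
      infix-endpoint xs _ zs isPath qs-isPath

  -- Inner is not decidable, so whether σ splits ℓ is only known up to ¬¬; the theorem's
  -- conclusion is decidable, which lets the final proof discharge the double negation.
  splitting-cases : ∀ {L L' v σ ℓ ℓ'} → IsSplitting A L L' v σ → ℓ ∈ L → ℓ' ∈ σ ℓ →
    ¬ ¬ (ℓ' ≡ ℓ ⊎ Inner A ℓ v × ℓ' ∈ (proj₁ ℓ , v) ∷ (v , proj₂ ℓ) ∷ [])
  splitting-cases {ℓ' = ℓ'} splitting ℓ∈L ℓ'∈σℓ = ¬¬-map cases ¬¬-excluded-middle
    where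
      cases : Dec (_ ∈ _ × Inner A _ _) → ℓ' ≡ _ ⊎ Inner A _ _ × ℓ' ∈ _
      cases (yes split) = inj₂ (proj₂ split , subst (ℓ' ∈_) (proj₁ (splitting _ ℓ∈L) split) ℓ'∈σℓ)
      cases (no kept) with subst (ℓ' ∈_) (proj₂ (splitting _ ℓ∈L) kept) ℓ'∈σℓ
      ... | here ℓ'≡ℓ = inj₁ ℓ'≡ℓ

proposition9p15 :
    (n : ℕ) (A : List (Arc n)) (L : List (Link n)) (c : Link n → ℚ) →
    IsOrientedTree A → Unique L → ShadowComplete A L c →
    (M : Arc n → Link n → ℚ) → IsCoverageMatrix A L M →
    (a : Arc n) → a ∈ A → (u : Vertex n) → IsEndpoint u a →
    (x : Link n → ℚ) → Feasible A L M x →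
    (∀ ℓ → InSupp L x ℓ → Covers A ℓ a → IsEndpoint u ℓ) →
    (v : Vertex n) (L' : List (Link n)) → (∀ ℓ → ℓ ∈ L' → ℓ ∈ L) →
    (σ : Link n → List (Link n)) → IsSplitting A L L' v σ →
    ∀ ℓ → InSupp L (split L x σ) ℓ → Covers A ℓ a → IsEndpoint u ℓ
proposition9p15 n A L c tree _ _ M _ a _ u u∈∂a x _ supp-endpoint v L' _ σ splitting
                ℓ' (_ , 0<x'ℓ') covers@(_ , path , consecutive)
  with ℓ , ℓ∈supp , ℓ'∈σℓ ← split-positive⁻ L x σ ℓ' 0<x'ℓ' =
  decidable-stable (isEndpoint? u ℓ') (¬¬-map endpoint (splitting-cases A splitting (proj₁ ℓ∈supp) ℓ'∈σℓ))
  where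
    endpoint : ℓ' ≡ ℓ ⊎ Inner A ℓ v × ℓ' ∈ (proj₁ ℓ , v) ∷ (v , proj₂ ℓ) ∷ [] → IsEndpoint u ℓ'
    endpoint (inj₁ refl) = supp-endpoint ℓ' ℓ∈supp covers
    endpoint (inj₂ (inner , half)) =
      shadow-endpoint A tree shadow path (consecutive-endpoint A consecutive u∈∂a)
        (supp-endpoint ℓ ℓ∈supp (shadow-covers A tree shadow covers))
      where
        shadow : Shadow A ℓ ℓ'
        shadow = inner-half-shadow A inner half
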